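{- Let $\mathbf{D}$ be a D-core algebra and $x,y\in D$. Then: (1a) $x\sqcup(\bot\sqcup y)=x\sqcup y$, (1b) $x\sqcap(\top\sqcap y)=x\sqcap y$; (2a) $(\bot\sqcap x)\sqcup y=\bot\sqcup y$, (2b) $(\top\sqcup x)\sqcap y=\top\sqcap y$; (3a) $(\bot\sqcap x)\sqcap(\bot\sqcup y)=\bot\sqcap x$, (3b) $(\top\sqcup x)\sqcup(\top\sqcap y)=\top\sqcup x$; (4a) $(\bot\sqcap x)\sqcap\neg(x\sqcap\neg y)=(\bot\sqcap x)\sqcap y$, (4b) $(\top\sqcup x)\sqcup\lrcorner(x\sqcup\lrcorner y)=(\top\sqcup x)\sqcup y$.
   Context: Write $x\vee y:=\neg(\neg x\sqcap\neg y)$ and $x\wedge y:=\lrcorner(\lrcorner x\sqcup\lrcorner y)$. A D-core algebra is an algebra $(D;\sqcap,\sqcup,\neg,\lrcorner,\top,\bot)$ of type $(2,2,1,1,0,0)$ satisfying, for all $x,y,z\in D$: $x\sqcap y=y\sqcap x$; $x\sqcup y=y\sqcup x$; $\neg(x\sqcap x)=\neg x$; $\lrcorner(x\sqcup x)=\lrcorner x$; $x\sqcap(x\sqcup y)=x\sqcap x$; $x\sqcup(x\sqcap y)=x\sqcup x$; $x\sqcap(y\vee z)=(x\sqcap y)\vee(x\sqcap z)$; $x\sqcup(y\wedge z)=(x\sqcup y)\wedge(x\sqcup z)$; $\neg\neg(x\sqcap y)=x\sqcap y$; $\lrcorner\lrcorner(x\sqcup y)=x\sqcup y$; $x\sqcap\neg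 x=\bot$; $x\sqcup\lrcorner x=\top$; $(x\sqcap x)\sqcup(x\sqcap x)=(x\sqcup x)\sqcap(x\sqcup x)$. -}

module Defs where

open import Level using (Level; suc)
open import Relation.Binary.PropositionalEquality using (_≡_)

record DCoreAlgebra (a : Level) : Set (suc a) where
  infixr 7 _⊓_
  infixr 6 _⊔_
  field
    Carrier : Set a
    _⊓_ _⊔_ : Carrier → Carrier → Carrier
    ¬_ ⌟_ : Carrier → Carrier
    ⊤ ⊥ : Carrier

  _∨_ : Carrier → Carrier → Carrier
  x ∨ y = ¬ ((¬ x) ⊓ (¬ y))

  _∧_ : Carrier → Carrier → Carrier
  x ∧ y = ⌟ ((⌟ x) ⊔ (⌟ y))

  field
    ⊓-comm : ∀ x y → x ⊓ y ≡ y ⊓ x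
    ⊔-comm : ∀ x y → x ⊔ y ≡ y ⊔ x
    ¬-idem : ∀ x → ¬ (x ⊓ x) ≡ ¬ x
    ⌟-idem : ∀ x → ⌟ (x ⊔ x) ≡ ⌟ x
    ⊓-absorb : ∀ x y → x ⊓ (x ⊔ y) ≡ x ⊓ x
    ⊔-absorb : ∀ x y → x ⊔ (x ⊓ y) ≡ x ⊔ x
    ⊓-distrib-∨ : ∀ x y z → x ⊓ (y ∨ z) ≡ (x ⊓ y) ∨ (x ⊓ z)
    ⊔-distrib-∧ : ∀ x y z → x ⊔ (y ∧ z) ≡ (x ⊔ y) ∧ (x ⊔ z)
    ¬¬-⊓ : ∀ x y → ¬ (¬ (x ⊓ y)) ≡ x ⊓ y
    ⌟⌟-⊔ : ∀ x y → ⌟ (⌟ (x ⊔ y)) ≡ x ⊔ y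
    ⊓-¬ : ∀ x → x ⊓ (¬ x) ≡ ⊥
    ⊔-⌟ : ∀ x → x ⊔ (⌟ x) ≡ ⊤
    mixed : ∀ x → (x ⊓ x) ⊔ (x ⊓ x) ≡ (x ⊔ x) ⊓ (x ⊔ x)

{-# OPTIONS --safe #-}
-- Every item rests on ⊥ being a zero for ⊓: distributivity gives
-- x ⊓ ⊥ = (x ⊓ ⊥) ∨ (x ⊓ ¬ x) = x ⊓ (⊥ ∨ ¬ x) = x ⊓ ¬ x = ⊥, where both uses of ⊥
-- as a unit for ∨ come from z ⊓ ¬ ⊥ = z ⊓ z.
-- Each (b) item is the (a) item of the dual algebra (⊓ ↔ ⊔, ¬ ↔ ⌟, ⊤ ↔ ⊥).
module Submission where

open import Defs
open import Level using (Level)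
open import Data.Product using (_×_; _,_)
open import Relation.Binary.PropositionalEquality using (_≡_; sym; trans; cong)
open Relation.Binary.PropositionalEquality.≡-Reasoning

dual : ∀ {a} → DCoreAlgebra a → DCoreAlgebra a
dual D = record
  { Carrier = Carrier ; _⊓_ = _⊔_ ; _⊔_ = _⊓_ ; ¬_ = ⌟_ ; ⌟_ = ¬_ ; ⊤ = ⊥ ; ⊥ = ⊤
  ; ⊓-comm = ⊔-comm ; ⊔-comm = ⊓-comm ; ¬-idem = ⌟-idem ; ⌟-idem = ¬-idem
  ; ⊓-absorb = ⊔-absorb ; ⊔-absorb = ⊓-absorb
  ; ⊓-distrib-∨ = ⊔-distrib-∧ ; ⊔-distrib-∧ = ⊓-distrib-∨
  ; ¬¬-⊓ = ⌟⌟-⊔ ; ⌟⌟-⊔ = ¬¬-⊓ ; ⊓-¬ = ⊔-⌟ ; ⊔-⌟ = ⊓-¬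
  ; mixed = λ x → sym (mixed x)
  }
  where open DCoreAlgebra D

module MeetProperties {a} (D : DCoreAlgebra a) where
  open DCoreAlgebra D

  ¬¬x≡x⊓x : ∀ x → ¬ (¬ x) ≡ x ⊓ x
  ¬¬x≡x⊓x x = trans (cong ¬_ (sym (¬-idem x))) (¬¬-⊓ x x)

  ¬¬¬x≡¬x : ∀ x → ¬ (¬ (¬ x)) ≡ ¬ x
  ¬¬¬x≡¬x x = trans (cong ¬_ (¬¬x≡x⊓x x)) (¬-idem x)

  x⊓[y⊓y]≡x⊓y : ∀ x y → x ⊓ (y ⊓ y) ≡ x ⊓ y
  x⊓[y⊓y]≡x⊓y x y = begin
    x ⊓ (y ⊓ y)        ≡⟨ cong (x ⊓_) (sym (trans (¬-idem (¬ y)) (¬¬x≡x⊓x y))) ⟩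
    x ⊓ (y ∨ y)        ≡⟨ ⊓-distrib-∨ x y y ⟩
    (x ⊓ y) ∨ (x ⊓ y)  ≡⟨ trans (¬-idem (¬ (x ⊓ y))) (¬¬-⊓ x y) ⟩
    x ⊓ y              ∎

  x⊓⊤≡x⊓x : ∀ x → x ⊓ ⊤ ≡ x ⊓ x
  x⊓⊤≡x⊓x x = trans (cong (x ⊓_) (sym (⊔-⌟ x))) (⊓-absorb x (⌟ x))

  x⊓¬⊥≡x⊓x : ∀ x → x ⊓ (¬ ⊥) ≡ x ⊓ x
  x⊓¬⊥≡x⊓x x = begin
    x ⊓ (¬ ⊥)                ≡⟨ cong (λ t → x ⊓ (¬ t)) ⊥≡¬⊤⊓¬⊤ ⟩
    x ⊓ (¬ ((¬ ⊤) ⊓ (¬ ⊤)))  ≡⟨ cong (x ⊓_) (trans (¬-idem (¬ ⊤)) (¬¬x≡x⊓x ⊤)) ⟩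
    x ⊓ (⊤ ⊓ ⊤)              ≡⟨ x⊓[y⊓y]≡x⊓y x ⊤ ⟩
    x ⊓ ⊤                    ≡⟨ x⊓⊤≡x⊓x x ⟩
    x ⊓ x                    ∎
    where
    ⊥≡¬⊤⊓¬⊤ : ⊥ ≡ (¬ ⊤) ⊓ (¬ ⊤)
    ⊥≡¬⊤⊓¬⊤ = trans (sym (⊓-¬ ⊤)) (trans (⊓-comm ⊤ (¬ ⊤)) (x⊓⊤≡x⊓x (¬ ⊤)))

  [x⊓y]∨⊥≡x⊓y : ∀ x y → (x ⊓ y) ∨ ⊥ ≡ x ⊓ y
  [x⊓y]∨⊥≡x⊓y x y = begin
    ¬ ((¬ (x ⊓ y)) ⊓ (¬ ⊥))           ≡⟨ cong ¬_ (x⊓¬⊥≡x⊓x (¬ (x ⊓ y))) ⟩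
    ¬ ((¬ (x ⊓ y)) ⊓ (¬ (x ⊓ y)))     ≡⟨ ¬-idem (¬ (x ⊓ y)) ⟩
    ¬ (¬ (x ⊓ y))                     ≡⟨ ¬¬-⊓ x y ⟩
    x ⊓ y                             ∎

  ⊓-zeroʳ : ∀ x → x ⊓ ⊥ ≡ ⊥
  ⊓-zeroʳ x = begin
    x ⊓ ⊥                            ≡⟨ sym ([x⊓y]∨⊥≡x⊓y x ⊥) ⟩
    (x ⊓ ⊥) ∨ ⊥                      ≡⟨ cong ((x ⊓ ⊥) ∨_) (sym (⊓-¬ x)) ⟩
    (x ⊓ ⊥) ∨ (x ⊓ (¬ x))            ≡⟨ sym (⊓-distrib-∨ x ⊥ (¬ x)) ⟩
    x ⊓ (¬ ((¬ ⊥) ⊓ (¬ (¬ x))))      ≡⟨ cong (λ t → x ⊓ (¬ t)) (⊓-comm (¬ ⊥) (¬ (¬ x))) ⟩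
    x ⊓ (¬ ((¬ (¬ x)) ⊓ (¬ ⊥)))      ≡⟨ cong (λ t → x ⊓ (¬ t)) (x⊓¬⊥≡x⊓x (¬ (¬ x))) ⟩
    x ⊓ (¬ ((¬ (¬ x)) ⊓ (¬ (¬ x))))  ≡⟨ cong (x ⊓_) (trans (¬-idem (¬ (¬ x))) (¬¬¬x≡¬x x)) ⟩
    x ⊓ (¬ x)                        ≡⟨ ⊓-¬ x ⟩
    ⊥                                ∎

  ⊓-zeroˡ : ∀ x → ⊥ ⊓ x ≡ ⊥
  ⊓-zeroˡ x = trans (⊓-comm ⊥ x) (⊓-zeroʳ x)

  x⊓[⊤⊓y]≡x⊓y : ∀ x y → x ⊓ (⊤ ⊓ y) ≡ x ⊓ y
  x⊓[⊤⊓y]≡x⊓y x y = begin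
    x ⊓ (⊤ ⊓ y)  ≡⟨ cong (x ⊓_) (trans (⊓-comm ⊤ y) (x⊓⊤≡x⊓x y)) ⟩
    x ⊓ (y ⊓ y)  ≡⟨ x⊓[y⊓y]≡x⊓y x y ⟩
    x ⊓ y        ∎

  [⊥⊓x]⊔y≡⊥⊔y : ∀ x y → (⊥ ⊓ x) ⊔ y ≡ ⊥ ⊔ y
  [⊥⊓x]⊔y≡⊥⊔y x y = cong (_⊔ y) (⊓-zeroˡ x)

  [⊥⊓x]⊓[⊥⊔y]≡⊥⊓x : ∀ x y → (⊥ ⊓ x) ⊓ (⊥ ⊔ y) ≡ ⊥ ⊓ x
  [⊥⊓x]⊓[⊥⊔y]≡⊥⊓x x y = begin
    (⊥ ⊓ x) ⊓ (⊥ ⊔ y)  ≡⟨ cong (_⊓ (⊥ ⊔ y)) (⊓-zeroˡ x) ⟩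
    ⊥ ⊓ (⊥ ⊔ y)        ≡⟨ ⊓-absorb ⊥ y ⟩
    ⊥ ⊓ ⊥              ≡⟨ ⊓-zeroˡ ⊥ ⟩
    ⊥                  ≡⟨ sym (⊓-zeroˡ x) ⟩
    ⊥ ⊓ x              ∎

  [⊥⊓x]⊓¬[x⊓¬y]≡[⊥⊓x]⊓y : ∀ x y → (⊥ ⊓ x) ⊓ (¬ (x ⊓ (¬ y))) ≡ (⊥ ⊓ x) ⊓ y
  [⊥⊓x]⊓¬[x⊓¬y]≡[⊥⊓x]⊓y x y = begin
    (⊥ ⊓ x) ⊓ (¬ (x ⊓ (¬ y)))  ≡⟨ cong (_⊓ (¬ (x ⊓ (¬ y)))) (⊓-zeroˡ x) ⟩
    ⊥ ⊓ (¬ (x ⊓ (¬ y)))        ≡⟨ ⊓-zeroˡ _ ⟩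
    ⊥                          ≡⟨ sym (⊓-zeroˡ y) ⟩
    ⊥ ⊓ y                      ≡⟨ cong (_⊓ y) (sym (⊓-zeroˡ x)) ⟩
    (⊥ ⊓ x) ⊓ y                ∎

proposition3p6 : ∀ {a : Level} (D : DCoreAlgebra a) → let open DCoreAlgebra D in
    ∀ (x y : Carrier) →
      ((x ⊔ (⊥ ⊔ y) ≡ x ⊔ y) × (x ⊓ (⊤ ⊓ y) ≡ x ⊓ y))
      × (((⊥ ⊓ x) ⊔ y ≡ ⊥ ⊔ y) × ((⊤ ⊔ x) ⊓ y ≡ ⊤ ⊓ y))
      × (((⊥ ⊓ x) ⊓ (⊥ ⊔ y) ≡ ⊥ ⊓ x) × ((⊤ ⊔ x) ⊔ (⊤ ⊓ y) ≡ ⊤ ⊔ x))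
      × (((⊥ ⊓ x) ⊓ (¬ (x ⊓ (¬ y))) ≡ (⊥ ⊓ x) ⊓ y)
         × ((⊤ ⊔ x) ⊔ (⌟ (x ⊔ (⌟ y))) ≡ (⊤ ⊔ x) ⊔ y))
proposition3p6 D x y =
    (J.x⊓[⊤⊓y]≡x⊓y x y , M.x⊓[⊤⊓y]≡x⊓y x y)
  , (M.[⊥⊓x]⊔y≡⊥⊔y x y , J.[⊥⊓x]⊔y≡⊥⊔y x y)
  , (M.[⊥⊓x]⊓[⊥⊔y]≡⊥⊓x x y , J.[⊥⊓x]⊓[⊥⊔y]≡⊥⊓x x y)
  , (M.[⊥⊓x]⊓¬[x⊓¬y]≡[⊥⊓x]⊓y x y , J.[⊥⊓x]⊓¬[x⊓¬y]≡[⊥⊓x]⊓y x y)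
  where
  module M = MeetProperties D
  module J = MeetProperties (dual D)
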